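{- Let $\mathcal{F} \subset \mathcal{P}([n])$ be an $r$-closed $\theta$-intersecting family, where $r \geq 3$ and $\theta = a/b \in (0,1)$ with $a,b$ positive integers and $\gcd(a,b) = 1$. Let $A \in \mathcal{F}$ with $b \nmid |A|$. Then $A \in \mathcal{F}_{\mathrm{exc}}$, and there is at most one such set $A$ in $\mathcal{F}$. Moreover, if $S_{\mathrm{nor}} \neq \emptyset$, then $\mathrm{core}(\mathcal{F}(i_{\max})) \subseteq A$.
   Context: A family $\mathcal{F} \subset \mathcal{P}([n])$ is $r$-closed $\theta$-intersecting if for each $2 \leq t \leq r$ and any $t$ distinct sets $A_1,\dots,A_t \in \mathcal{F}$ we have $|A_1 \cap \dots \cap A_t| \in \{\theta|A_1|, \dots, \theta|A_t|\}$. $\mathcal{F}(i) := \mathcal{F} \cap \binom{[n]}{i}$. For $A \in \mathcal{F}$, $\mathrm{Tor}(A) := \{B \in \mathcal{F} : |B| \geq |A|,\ |A \cap B| = \theta|A|\}$. When $\mathrm{Tor}(A) \neq \emptyset$, $\mathrm{core}(A) := A \cap B$ for any $B \in \mathrm{Tor}(A)$ (independent of the choice of $B$). $S := \{i \in [n] : \mathcal{F}(i) \neq \emptyset\}$, $S_{\mathrm{nor}} := \{i \in S : \mathrm{Tor}(A) \neq \emptyset \text{ for all } A \in \mathcal{F}(i)\}$, $S_{\mathrm{exc}} := S \setminus S_{\mathrm{nor}}$, $i_{\max} := \max S_{\mathrm{nor}}$, $\mathcal{F}_{\mathrm{exc}} := \bigcup_{i \in S_{\mathrm{exc}}} \mathcal{F}(i)$.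 For $i \in S_{\mathrm{nor}}$, all sets in $\mathcal{F}(i)$ have the same core, denoted $\mathrm{core}(\mathcal{F}(i))$. -}

module Defs where

open import Data.Nat using (ℕ; _≤_; _*_)
open import Data.Bool using (Bool; true)
open import Data.Fin using (Fin)
open import Data.Fin.Subset using (Subset; _∩_; ⋂; ∣_∣)
open import Data.List using (tabulate)
open import Data.Product using (Σ; ∃; _×_)
open import Relation.Binary.PropositionalEquality using (_≡_)
open import Relation.Nullary using (¬_)
open import Function.Definitions using (Injective)

Family : ℕ → Set
Family n = Subset n → Bool

_∈F_ : ∀ {n} → Subset n → Family n → Set
A ∈F F = F A ≡ true

-- θ = a / b.  "|X| = θ|A|" is encoded as  b * |X| ≡ a * |A|.
_≡θ[_/_]_ : ℕ → ℕ → ℕ → ℕ → Set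
x ≡θ[ a / b ] y = b * x ≡ a * y

⋂ᶠ : ∀ {n t} → (Fin t → Subset n) → Subset n
⋂ᶠ As = ⋂ (tabulate As)

RClosedThetaIntersecting : ∀ {n} → ℕ → ℕ → ℕ → Family n → Set
RClosedThetaIntersecting {n} r a b F =
  ∀ (t : ℕ) → 2 ≤ t → t ≤ r →
  (As : Fin t → Subset n) → Injective _≡_ _≡_ As → (∀ j → As j ∈F F) →
  ∃ λ j → ∣ ⋂ᶠ As ∣ ≡θ[ a / b ] ∣ As j ∣

InTor : ∀ {n} → ℕ → ℕ → Family n → Subset n → Subset n → Set
InTor a b F A B = B ∈F F × ∣ A ∣ ≤ ∣ B ∣ × ∣ A ∩ B ∣ ≡θ[ a / b ] ∣ A ∣

InS : ∀ {n} → Family n → ℕ → Set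
InS F i = ∃ λ A → A ∈F F × ∣ A ∣ ≡ i

InSnor : ∀ {n} → ℕ → ℕ → Family n → ℕ → Set
InSnor a b F i = InS F i × (∀ A → A ∈F F → ∣ A ∣ ≡ i → ∃ λ B → InTor a b F A B)

InSexc : ∀ {n} → ℕ → ℕ → Family n → ℕ → Set
InSexc a b F i = InS F i × ¬ InSnor a b F i

InFexc : ∀ {n} → ℕ → ℕ → Family n → Subset n → Set
InFexc a b F A = A ∈F F × InSexc a b F ∣ A ∣

IsImax : ∀ {n} → ℕ → ℕ → Family n → ℕ → Set
IsImax a b F i = InSnor a b F i × (∀ j → InSnor a b F j → j ≤ i)

CoreSubset : ∀ {n} → ℕ → ℕ → Family n → ℕ → Subset n → Set
CoreSubset {n} a b F i X =
  ∀ (C B : Subset n) → C ∈F F → ∣ C ∣ ≡ i → InTor a b F C B →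
  Data.Fin.Subset._⊆_ (C ∩ B) X

{-# OPTIONS --safe #-}
-- If b ∤ |A| then no intersection of sets of F that includes A can have size θ|A|,
-- since b|X| = a|A| with gcd(a, b) = 1 forces b ∣ |A|.  Hence Tor(A) is empty, two
-- such sets cannot coexist, and for a normal set C with B ∈ Tor(C) the triple
-- intersection C ∩ B ∩ A has size θ|C| or θ|B|, both at least |C ∩ B| = θ|C|,
-- which forces core(C) = C ∩ B ⊆ A.
module Submission where

open import Defs
open import Data.Nat using (ℕ; zero; suc; _≤_; _<_; _*_; z≤n; s≤s; >-nonZero)
open import Data.Nat.Properties
  using (≤-refl; ≤-trans; <⇒≢; <⇒≱; *-comm; *-monoʳ-≤; *-monoˡ-<; *-cancelˡ-≤; m<n⇒0<n; module ≤-Reasoning)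
open import Data.Nat.Divisibility using (_∣_; divides)
open import Data.Nat.Coprimality using (Coprime; coprime-divisor) renaming (sym to coprime-sym)
open import Data.Bool using () renaming (_≟_ to _≟ᵇ_)
open import Data.Fin using (Fin; zero; suc)
open import Data.Fin.Subset using (Subset; ∣_∣; _∩_; _⊆_; _⊂_)
open import Data.Fin.Subset.Properties
  using (_∈?_; p∩q⊆p; p∩q⊆q; x∈p∩q⁻; p⊂q⇒∣p∣<∣q∣; ∩-assoc; ∩-idem; ∩-identityʳ)
open import Data.Vec.Properties using (≡-dec)
open import Data.Product using (∃; _×_; _,_; proj₂)
open import Data.Sum using (_⊎_; inj₁; inj₂)
open import Function using (_∘_)
open import Function.Definitions using (Injective)
open import Relation.Binary.PropositionalEquality
  using (_≡_; _≢_; refl; sym; trans; cong; subst; module ≡-Reasoning)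
open import Relation.Nullary using (¬_; Dec; yes; no; contradiction)

_≟ₛ_ : ∀ {n} (p q : Subset n) → Dec (p ≡ q)
_≟ₛ_ = ≡-dec _≟ᵇ_

∣p∣≤∣p∩q∣⇒p⊆q : ∀ {n} {p q : Subset n} → ∣ p ∣ ≤ ∣ p ∩ q ∣ → p ⊆ q
∣p∣≤∣p∩q∣⇒p⊆q {p = p} {q} ∣p∣≤∣p∩q∣ {x} x∈p with x ∈? q
... | yes x∈q = x∈q
... | no  x∉q = contradiction ∣p∣≤∣p∩q∣ (<⇒≱ (p⊂q⇒∣p∣<∣q∣ p∩q⊂p))
  where
  p∩q⊂p : p ∩ q ⊂ p
  p∩q⊂p = p∩q⊆p p q , x , x∈p , x∉q ∘ proj₂ ∘ x∈p∩q⁻ p q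

module ThetaArithmetic (a b : ℕ) where

  ≡θ⇒b∣ : ∀ {x y} → Coprime a b → x ≡θ[ a / b ] y → b ∣ y
  ≡θ⇒b∣ {x} {y} a⊥b bx≡ay = coprime-divisor (coprime-sym a⊥b) (divides x (begin
    a * y ≡⟨ sym bx≡ay ⟩
    b * x ≡⟨ *-comm b x ⟩
    x * b ∎))
    where open ≡-Reasoning

  ≡θ-self⇒≡0 : ∀ {x} → a < b → x ≡θ[ a / b ] x → x ≡ 0
  ≡θ-self⇒≡0 {zero}  _   _      = refl
  ≡θ-self⇒≡0 {suc x} a<b bx≡ax =
    contradiction (sym bx≡ax) (<⇒≢ (*-monoˡ-< (suc x) a<b))

  ≡θ-mono : ∀ {x x′ y y′} → 0 < b → y ≤ y′ →
            x ≡θ[ a / b ] y → x′ ≡θ[ a / b ] y′ → x ≤ x′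
  ≡θ-mono {x} {x′} 0<b y≤y′ bx≡ay bx′≡ay′ = *-cancelˡ-≤ b ⦃ >-nonZero 0<b ⦄ (begin
    b * x   ≡⟨ bx≡ay ⟩
    a * _   ≤⟨ *-monoʳ-≤ a y≤y′ ⟩
    a * _   ≡⟨ sym bx′≡ay′ ⟩
    b * x′  ∎)
    where open ≤-Reasoning

pair : ∀ {n} → Subset n → Subset n → Fin 2 → Subset n
pair X Y zero    = X
pair X Y (suc _) = Y

pair-injective : ∀ {n} {X Y : Subset n} → X ≢ Y → Injective _≡_ _≡_ (pair X Y)
pair-injective X≢Y {zero}     {zero}     _ = refl
pair-injective X≢Y {zero}     {suc zero} e = contradiction e X≢Y
pair-injective X≢Y {suc zero} {zero}     e = contradiction (sym e) X≢Y
pair-injective X≢Y {suc zero} {suc zero} _ = refl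

triple : ∀ {n} → Subset n → Subset n → Subset n → Fin 3 → Subset n
triple X Y Z zero          = X
triple X Y Z (suc zero)    = Y
triple X Y Z (suc (suc _)) = Z

triple-injective : ∀ {n} {X Y Z : Subset n} → X ≢ Y → X ≢ Z → Y ≢ Z →
                   Injective _≡_ _≡_ (triple X Y Z)
triple-injective X≢Y X≢Z Y≢Z {zero}          {zero}           _ = refl
triple-injective X≢Y X≢Z Y≢Z {zero}          {suc zero}       e = contradiction e X≢Y
triple-injective X≢Y X≢Z Y≢Z {zero}          {suc (suc zero)} e = contradiction e X≢Z
triple-injective X≢Y X≢Z Y≢Z {suc zero}      {zero}           e = contradiction (sym e) X≢Y
triple-injective X≢Y X≢Z Y≢Z {suc zero}      {suc zero}       _ = refl
triple-injective X≢Y X≢Z Y≢Z {suc zero}      {suc (suc zero)} e = contradiction e Y≢Z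
triple-injective X≢Y X≢Z Y≢Z {suc (suc zero)} {zero}          e = contradiction (sym e) X≢Z
triple-injective X≢Y X≢Z Y≢Z {suc (suc zero)} {suc zero}      e = contradiction (sym e) Y≢Z
triple-injective X≢Y X≢Z Y≢Z {suc (suc zero)} {suc (suc zero)} _ = refl

⋂ᶠ-pair : ∀ {n} (X Y : Subset n) → ⋂ᶠ (pair X Y) ≡ X ∩ Y
⋂ᶠ-pair X Y = cong (X ∩_) (∩-identityʳ Y)

⋂ᶠ-triple : ∀ {n} (X Y Z : Subset n) → ⋂ᶠ (triple X Y Z) ≡ (X ∩ Y) ∩ Z
⋂ᶠ-triple X Y Z = trans (cong (λ W → X ∩ (Y ∩ W)) (∩-identityʳ Z)) (sym (∩-assoc X Y Z))

module Intersections {n r a b : ℕ} {F : Family n}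
                     (closed : RClosedThetaIntersecting r a b F) where

  intersection₂ : ∀ {X Y} → 2 ≤ r → X ∈F F → Y ∈F F → X ≢ Y →
    ∣ X ∩ Y ∣ ≡θ[ a / b ] ∣ X ∣ ⊎ ∣ X ∩ Y ∣ ≡θ[ a / b ] ∣ Y ∣
  intersection₂ {X} {Y} 2≤r X∈F Y∈F X≢Y
    with closed 2 ≤-refl 2≤r (pair X Y) (pair-injective X≢Y)
                (λ { zero → X∈F ; (suc zero) → Y∈F })
  ... | zero     , e = inj₁ (subst (λ W → b * ∣ W ∣ ≡ _) (⋂ᶠ-pair X Y) e)
  ... | suc zero , e = inj₂ (subst (λ W → b * ∣ W ∣ ≡ _) (⋂ᶠ-pair X Y) e)

  intersection₃ : ∀ {X Y Z} → 3 ≤ r → X ∈F F → Y ∈F F → Z ∈F F →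
    X ≢ Y → X ≢ Z → Y ≢ Z →
    ∣ (X ∩ Y) ∩ Z ∣ ≡θ[ a / b ] ∣ X ∣ ⊎ ∣ (X ∩ Y) ∩ Z ∣ ≡θ[ a / b ] ∣ Y ∣
      ⊎ ∣ (X ∩ Y) ∩ Z ∣ ≡θ[ a / b ] ∣ Z ∣
  intersection₃ {X} {Y} {Z} 3≤r X∈F Y∈F Z∈F X≢Y X≢Z Y≢Z
    with closed 3 (s≤s (s≤s z≤n)) 3≤r (triple X Y Z) (triple-injective X≢Y X≢Z Y≢Z)
                (λ { zero → X∈F ; (suc zero) → Y∈F ; (suc (suc zero)) → Z∈F })
  ... | zero           , e = inj₁ (subst (λ W → b * ∣ W ∣ ≡ _) (⋂ᶠ-triple X Y Z) e)
  ... | suc zero       , e = inj₂ (inj₁ (subst (λ W → b * ∣ W ∣ ≡ _) (⋂ᶠ-triple X Y Z) e))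
  ... | suc (suc zero) , e = inj₂ (inj₂ (subst (λ W → b * ∣ W ∣ ≡ _) (⋂ᶠ-triple X Y Z) e))

module Indivisible {n r a b : ℕ} {F : Family n}
                   (3≤r : 3 ≤ r) (a<b : a < b) (a⊥b : Coprime a b)
                   (closed : RClosedThetaIntersecting r a b F)
                   {A : Subset n} (A∈F : A ∈F F) (b∤A : ¬ b ∣ ∣ A ∣) where

  open Intersections {a = a} {b = b} {F = F} closed
  open ThetaArithmetic a b

  0<b : 0 < b
  0<b = m<n⇒0<n a<b

  Tor-empty : ∀ B → ¬ InTor a b F A B
  Tor-empty B (_ , _ , A∩B≡θA) = b∤A (≡θ⇒b∣ a⊥b A∩B≡θA)

  exceptional : InFexc a b F A
  exceptional = A∈F , (A , A∈F , refl) , λ (_ , normal) →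
    let B , B∈TorA = normal A A∈F refl in Tor-empty B B∈TorA

  unique : ∀ A′ → A′ ∈F F → ¬ b ∣ ∣ A′ ∣ → A′ ≡ A
  unique A′ A′∈F b∤A′ with A′ ≟ₛ A
  ... | yes A′≡A = A′≡A
  ... | no  A′≢A with intersection₂ (≤-trans (s≤s (s≤s z≤n)) 3≤r) A′∈F A∈F A′≢A
  ...   | inj₁ e = contradiction (≡θ⇒b∣ a⊥b e) b∤A′
  ...   | inj₂ e = contradiction (≡θ⇒b∣ a⊥b e) b∤A

  core⊆ : ∀ {C B} → C ∈F F → InTor a b F C B → C ∩ B ⊆ A
  core⊆ {C} {B} C∈F (B∈F , ∣C∣≤∣B∣ , core≡θC) with B ≟ₛ A | C ≟ₛ B
  ... | yes refl | _        = p∩q⊆q C B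
  ... | no  _    | yes refl = ∣p∣≤∣p∩q∣⇒p⊆q (subst (_≤ ∣ (C ∩ C) ∩ A ∣) (sym ∣C∩C∣≡0) z≤n)
    where
    ∣C∩C∣≡0 : ∣ C ∩ C ∣ ≡ 0
    ∣C∩C∣≡0 = trans (cong ∣_∣ (∩-idem C))
                (≡θ-self⇒≡0 a<b (subst (λ W → b * ∣ W ∣ ≡ a * ∣ C ∣) (∩-idem C) core≡θC))
  ... | no  B≢A  | no  C≢B  with intersection₃ 3≤r C∈F B∈F A∈F C≢B C≢A B≢A
    where
    C≢A : C ≢ A
    C≢A refl = Tor-empty B (B∈F , ∣C∣≤∣B∣ , core≡θC)
  ...   | inj₁ e        = ∣p∣≤∣p∩q∣⇒p⊆q (≡θ-mono 0<b ≤-refl core≡θC e)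
  ...   | inj₂ (inj₁ e) = ∣p∣≤∣p∩q∣⇒p⊆q (≡θ-mono 0<b ∣C∣≤∣B∣ core≡θC e)
  ...   | inj₂ (inj₂ e) = contradiction (≡θ⇒b∣ a⊥b e) b∤A

lemma2p20 : (n r a b : ℕ) → 3 ≤ r → 0 < a → a < b → Coprime a b →
    (F : Family n) → RClosedThetaIntersecting r a b F →
    (A : Subset n) → A ∈F F → ¬ (b ∣ ∣ A ∣) →
    InFexc a b F A
    × (∀ (A′ : Subset n) → A′ ∈F F → ¬ (b ∣ ∣ A′ ∣) → A′ ≡ A)
    × ((∃ λ i → InSnor a b F i) → ∀ i → IsImax a b F i → CoreSubset a b F i A)
-- Every core lies in A.
lemma2p20 n r a b 3≤r _ a<b a⊥b F closed A A∈F b∤A =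
  exceptional , unique , λ _ _ _ C B C∈F _ B∈TorC → core⊆ C∈F B∈TorC
  where open Indivisible {F = F} 3≤r a<b a⊥b closed A∈F b∤A
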